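{- There is a constant $c>0$ such that for every $n \ge 2$, the path on $n$ vertices has neighbor-depth at least $c \log n$.
   Context: The neighbor-depth $\mathrm{nd}(G)$ is defined recursively: $\mathrm{nd}(G)=0$ iff $V(G)=\emptyset$; if $G$ is disconnected, $\mathrm{nd}(G)$ is the maximum of $\mathrm{nd}$ over its connected components; if $G$ is non-empty and connected, $\mathrm{nd}(G)\le k$ iff there is $v\in V(G)$ with $\mathrm{nd}(G\setminus N[v])\le k-1$ and $\mathrm{nd}(G\setminus\{v\})\le k$ ($N[v]$ the closed neighborhood, $G\setminus X=G[V(G)\setminus X]$). -}

module Defs where

open import Data.Nat using (ℕ; zero; suc; _+_)
open import Data.Fin using (Fin; toℕ)
open import Data.Product using (_×_; Σ)
open import Data.Sum using (_⊎_)
open import Data.Empty using (⊥)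
open import Data.Unit using (⊤)
open import Relation.Nullary using (¬_)
open import Relation.Binary.PropositionalEquality using (_≡_)

-- Vertex sets of induced subgraphs of an ambient graph on Fin m,
-- represented as predicates on the vertices.
VSet : ℕ → Set₁
VSet m = Fin m → Set

module _ {m : ℕ} (Adj : Fin m → Fin m → Set) where

  data Walk (S : VSet m) : Fin m → Fin m → Set where
    here : ∀ {u} → S u → Walk S u u
    step : ∀ {u w x} → S u → Adj u w → Walk S w x → Walk S u x

  IsEmpty : VSet m → Set
  IsEmpty S = ∀ u → ¬ S u

  Connected : VSet m → Set
  Connected S = ∀ u w → S u → S w → Walk S u w

  Comp : VSet m → Fin m → VSet m
  Comp S v u = S u × Walk S v u

  del : VSet m → Fin m → VSet m
  del S v u = S u × ¬ (u ≡ v)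

  delN : VSet m → Fin m → VSet m
  delN S v u = S u × ¬ (u ≡ v) × ¬ Adj v u

  -- NDle k S  means  nd(G[S]) ≤ k, following the recursive definition.
  data NDle : ℕ → VSet m → Set₁ where
    nd-empty : ∀ {k S} → IsEmpty S → NDle k S
    nd-disc  : ∀ {k S} → ¬ Connected S →
               (∀ v → S v → NDle k (Comp S v)) → NDle k S
    nd-conn  : ∀ {k S} (v : Fin m) → S v → Connected S →
               NDle k (delN S v) → NDle (suc k) (del S v) → NDle (suc k) S

PathAdj : (n : ℕ) → Fin n → Fin n → Set
PathAdj n u w = (suc (toℕ u) ≡ toℕ w) ⊎ (suc (toℕ w) ≡ toℕ u)

PathNDle : ℕ → ℕ → Set₁
PathNDle n k = NDle (PathAdj n) k (λ _ → ⊤)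

-- By induction on the derivation of nd(G[S]) ≤ k: every run [a, b) of consecutive
-- path vertices contained in S has b − a < 4^k. The component of G[S] meeting the
-- run contains all of it, and deleting a vertex outside the run keeps it. If the
-- chosen vertex v lies in the run, S ∖ N[v] still contains the parts of the run to
-- the left and to the right of N[v], each shorter than 4^(k−1), so
-- b − a ≤ 2(4^(k−1) − 1) + 3 < 4^k. For S = V(Pₙ) this gives n < 4^k = 2^(2k).
module Submission where

open import Defs
open import Data.Nat using (ℕ; zero; suc; pred; _+_; _∸_; _*_; _^_; _≤_; _<_; z≤n; s≤s; _≤?_; _<?_)
open import Data.Nat.Properties
open import Data.Nat.Logarithm using (⌊log₂_⌋; ⌊log₂⌋-mono-≤; ⌊log₂[2^n]⌋≡n)
open import Data.Nat.Tactic.RingSolver using (solve-∀)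
open import Data.Fin using (Fin; toℕ; fromℕ<)
open import Data.Fin.Properties using (toℕ-fromℕ<; toℕ-injective; toℕ<n)
open import Data.Product using (Σ; _×_; _,_; proj₁; proj₂)
open import Data.Sum using (_⊎_; inj₁; inj₂)
open import Data.Unit using (tt)
open import Data.Empty using (⊥-elim)
open import Relation.Nullary using (¬_; yes; no)
open import Relation.Unary using (_⊆_)
open import Relation.Binary.PropositionalEquality

<pred⇒suc< : ∀ {m n} → m < pred n → suc m < n
<pred⇒suc< {n = suc _} m<n = s≤s m<n

≤suc[pred] : ∀ n → n ≤ suc (pred n)
≤suc[pred] zero    = z≤n
≤suc[pred] (suc n) = ≤-refl

two-runs-bound : ∀ {a t b x} → 1 ≤ x → t ≤ a + x → b < suc (suc t) + x → b < a + 4 * x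
two-runs-bound {a} {t} {b} {x} 1≤x t≤a+x b<t+2+x = begin-strict
  b                    <⟨ b<t+2+x ⟩
  2 + t + x            ≤⟨ +-monoˡ-≤ x (+-mono-≤ (+-mono-≤ 1≤x 1≤x) t≤a+x) ⟩
  x + x + (a + x) + x  ≡⟨ regroup a x ⟩
  a + 4 * x            ∎
  where
  open ≤-Reasoning
  regroup : ∀ a x → x + x + (a + x) + x ≡ a + 4 * x
  regroup = solve-∀

module _ {n : ℕ} where

  Interval : ℕ → ℕ → VSet n
  Interval a b u = a ≤ toℕ u × toℕ u < b

  Interval-mono : ∀ {a a′ b b′} → a ≤ a′ → b′ ≤ b → Interval a′ b′ ⊆ Interval a b
  Interval-mono a≤a′ b′≤b (a′≤u , u<b′) = ≤-trans a≤a′ a′≤u , <-≤-trans u<b′ b′≤b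

  first-vertex : ∀ {a b} → a < b → b ≤ n → Σ (Fin n) (λ u → toℕ u ≡ a)
  first-vertex a<b b≤n = fromℕ< (<-≤-trans a<b b≤n) , toℕ-fromℕ< _

  walk-along : ∀ {S : VSet n} {w x} → toℕ w ≤ toℕ x →
               Interval (toℕ w) (suc (toℕ x)) ⊆ S → Walk (PathAdj n) S w x
  walk-along {S} {w} {x} w≤x = go (toℕ x ∸ toℕ w) w (m+[n∸m]≡n w≤x)
    where
    go : ∀ d w → toℕ w + d ≡ toℕ x → Interval (toℕ w) (suc (toℕ x)) ⊆ S → Walk (PathAdj n) S w x
    go zero w w+0≡x run with toℕ-injective (trans (sym (+-identityʳ (toℕ w))) w+0≡x)
    ... | refl = here (run (≤-refl , ≤-refl))
    go (suc d) w w+d≡x run =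
      step (run (≤-refl , s≤s (<⇒≤ w<x))) (inj₁ (sym (toℕ-fromℕ< w+1<n)))
           (go d w′ w′+d≡x (λ u∈ → run (Interval-mono w≤w′ ≤-refl u∈)))
      where
      w<x : toℕ w < toℕ x
      w<x = ≤-trans (s≤s (m≤m+n (toℕ w) d)) (≤-reflexive (trans (sym (+-suc (toℕ w) d)) w+d≡x))
      w+1<n : suc (toℕ w) < n
      w+1<n = ≤-<-trans w<x (toℕ<n x)
      w′ : Fin n
      w′ = fromℕ< w+1<n
      w≤w′ : toℕ w ≤ toℕ w′
      w≤w′ = ≤-trans (n≤1+n (toℕ w)) (≤-reflexive (sym (toℕ-fromℕ< w+1<n)))
      w′+d≡x : toℕ w′ + d ≡ toℕ x
      w′+d≡x = trans (cong (_+ d) (toℕ-fromℕ< w+1<n)) (trans (sym (+-suc (toℕ w) d)) w+d≡x)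

  ∉closedNbhd : ∀ {u v : Fin n} → suc (toℕ u) < toℕ v ⊎ suc (toℕ v) < toℕ u →
                ¬ u ≡ v × ¬ PathAdj n v u
  ∉closedNbhd (inj₁ u+1<v) =
    (λ { refl → <-asym u+1<v (n<1+n _) }) ,
    λ { (inj₁ e) → <-asym (<-trans (n<1+n _) u+1<v) (≤-reflexive e)
      ; (inj₂ e) → <-irrefl e u+1<v }
  ∉closedNbhd (inj₂ v+1<u) =
    (λ { refl → <-asym v+1<u (n<1+n _) }) ,
    λ { (inj₁ e) → <-irrefl e v+1<u
      ; (inj₂ e) → <-asym (≤-reflexive e) (<-trans (n<1+n _) v+1<u) }

  NDle⇒run<4^ : ∀ {k S} → NDle (PathAdj n) k S → ∀ {a b} → b ≤ n → Interval a b ⊆ S → b < a + 4 ^ k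
  NDle⇒run<4^ {k} nd≤k {a} {b} b≤n run with b ≤? a
  ... | yes b≤a = ≤-<-trans b≤a (m<m+n a (m^n>0 4 k))
  NDle⇒run<4^ (nd-empty empty) b≤n run | no b≰a with first-vertex (≰⇒> b≰a) b≤n
  ... | u , refl = ⊥-elim (empty u (run (≤-refl , ≰⇒> b≰a)))
  NDle⇒run<4^ (nd-disc _ comp) b≤n run | no b≰a with first-vertex (≰⇒> b≰a) b≤n
  ... | u , refl = NDle⇒run<4^ (comp u (run (≤-refl , ≰⇒> b≰a))) b≤n
        (λ { w∈@(u≤w , w<b) → run w∈ , walk-along u≤w (λ i → run (Interval-mono ≤-refl w<b i)) })
  NDle⇒run<4^ {suc k} (nd-conn v _ _ ndN ndD) {a} {b} b≤n run | no _
    with a ≤? toℕ v | toℕ v <? b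
  ... | yes a≤v | yes v<b =
    two-runs-bound (m^n>0 4 k) (≤-trans (≤suc[pred] (toℕ v)) left) right
    where
    left : pred (toℕ v) < a + 4 ^ k
    left = NDle⇒run<4^ ndN (≤-trans pred[n]≤n (<⇒≤ (<-≤-trans v<b b≤n)))
      λ { (a≤u , u<pred[v]) → run (a≤u , <-trans (<-trans (n<1+n _) (<pred⇒suc< u<pred[v])) v<b)
                          , ∉closedNbhd (inj₁ (<pred⇒suc< u<pred[v])) }
    right : b < suc (suc (toℕ v)) + 4 ^ k
    right = NDle⇒run<4^ ndN b≤n
      λ { (v+2≤u , u<b) → run (≤-trans a≤v (<⇒≤ (<-trans (n<1+n _) v+2≤u)) , u<b)
                          , ∉closedNbhd (inj₂ v+2≤u) }
  ... | no a≰v | _ = NDle⇒run<4^ ndD b≤n λ u∈ → run u∈ , λ { refl → a≰v (proj₁ u∈) }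
  ... | yes _ | no v≮b = NDle⇒run<4^ ndD b≤n λ u∈ → run u∈ , λ { refl → v≮b (proj₂ u∈) }

⌊log₂n⌋≤2*nd[Pₙ] : ∀ n k → PathNDle n k → ⌊log₂ n ⌋ ≤ 2 * k
⌊log₂n⌋≤2*nd[Pₙ] n k nd≤k = begin
  ⌊log₂ n ⌋             ≤⟨ ⌊log₂⌋-mono-≤ (<⇒≤ n<2^[2k]) ⟩
  ⌊log₂ (2 ^ (2 * k)) ⌋ ≡⟨ ⌊log₂[2^n]⌋≡n (2 * k) ⟩
  2 * k                 ∎
  where
  open ≤-Reasoning
  n<2^[2k] : n < 2 ^ (2 * k)
  n<2^[2k] = subst (n <_) (^-*-assoc 2 2 k) (NDle⇒run<4^ nd≤k ≤-refl (λ _ → tt))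

proposition5 : Σ ℕ (λ K → (1 ≤ K) × ((n : ℕ) → 2 ≤ n → (k : ℕ) → PathNDle n k → ⌊log₂ n ⌋ ≤ K * k))
proposition5 = 2 , s≤s z≤n , λ n _ → ⌊log₂n⌋≤2*nd[Pₙ] n
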